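{- Let $k\ge2$, $\ell\in\mathbb{N}$, and let $a\colon\mathbb{N}_0\to\{+1,-1\}$ be a sequence with $a(0)=+1$. Then the following are equivalent: (1) there exists a set $A\subset\Sigma_k^\ell\setminus\{\mathtt 0^\ell\}$ with $a=a_A$; (2) for each $b\in\mathcal N_k(a)$, the sequence $b/a$ is periodic with period $k^{\ell-1}$.
   Context: $\Sigma_k=\{\mathtt 0,\dots,k-1\}$; $(n)_k$ is the base-$k$ expansion of $n$ without leading zeros. For a word $v$ not of the form $\mathtt 0^j$ and $n\in\mathbb{N}_0$, $\#(v,n)$ is the number of pairs of words $(x,y)$ with $\mathtt 0^{|v|-1}(n)_k=xvy$; $a_A(n)=(-1)^{\sum_{v\in A}\#(v,n)}$. The $k$-kernel of $a$ is $\mathcal N_k(a)=\{n\mapsto a(k^\alpha n+r):\alpha\in\mathbb{N}_0,\ 0\le r<k^\alpha\}$. $b/a$ denotes the pointwise quotient. -}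

module Defs where

open import Data.Nat using (ℕ; zero; suc; _+_; _*_; _∸_; _^_; _≤_; _<_; s≤s; z≤n; NonZero; _≟_)
open import Data.Nat.DivMod using (_/_; _mod_)
open import Data.Fin using (Fin)
import Data.Fin as Fin
open import Data.List using (List; []; _∷_; _++_; [_]; length; take; replicate; map)
open import Data.Nat.ListAction using (sum)
open import Data.List.Properties using (≡-dec)
open import Data.Sign using (Sign; opposite) renaming (_*_ to _*ˢ_)
import Data.Sign as Sign
open import Data.Vec using (Vec; toList)
open import Relation.Nullary using (yes; no)
open import Relation.Binary.PropositionalEquality using (_≡_)

nz : ∀ {k} → 2 ≤ k → NonZero k
nz {suc k} _ = record { nonZero = _ }

-- (n)_k : base-k expansion of n, most significant digit first, no leading
-- zeros; (0)_k is the empty word.  The first argument is fuel (n suffices).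
digitsAux : (k : ℕ) → .{{NonZero k}} → ℕ → ℕ → List (Fin k)
digitsAux k zero n = []
digitsAux k (suc f) zero = []
digitsAux k (suc f) (suc n) = digitsAux k f (suc n / k) ++ [ suc n mod k ]

digits : (k : ℕ) → 2 ≤ k → ℕ → List (Fin k)
digits k hk n = let instance _ = nz hk in digitsAux k n n

zeroDigit : (k : ℕ) → 2 ≤ k → Fin k
zeroDigit k hk = let instance _ = nz hk in 0 mod k

-- number of pairs (x , y) with w = x v y, i.e. number of occurrences of v
-- as a factor of w
occ : ∀ {k} → List (Fin k) → List (Fin k) → ℕ
occ v [] with ≡-dec Fin._≟_ v []
... | yes _ = 1
... | no _ = 0
occ v (d ∷ w) with ≡-dec Fin._≟_ (take (length v) (d ∷ w)) v
... | yes _ = suc (occ v w)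
... | no _ = occ v w

#occ : (k : ℕ) → 2 ≤ k → List (Fin k) → ℕ → ℕ
#occ k hk v n = occ v (replicate (length v ∸ 1) (zeroDigit k hk) ++ digits k hk n)

signPow : ℕ → Sign
signPow zero = Sign.+
signPow (suc m) = opposite (signPow m)

-- a_A(n) = (-1)^{Σ_{v ∈ A} #(v , n)}, with A given as a duplicate-free list
-- of words of length ℓ
aA : (k : ℕ) → 2 ≤ k → (ℓ : ℕ) → List (Vec (Fin k) ℓ) → ℕ → Sign
aA k hk ℓ A n = signPow (sum (map (λ v → #occ k hk (toList v) n) A))

-- pointwise quotient of ±1-valued sequences: s / t = s * t⁻¹ = s * t
-- (every sign is its own inverse)
_÷_ : Sign → Sign → Sign
s ÷ t = s *ˢ t

HasPeriod : ℕ → (ℕ → Sign) → Set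
HasPeriod p f = ∀ n → f (n + p) ≡ f n

kernelElt : (k : ℕ) → (ℕ → Sign) → ℕ → ℕ → ℕ → Sign
kernelElt k a α r n = a (k ^ α * n + r)

module Submission where

-- Lemma 2.6.  Fix k ≥ 2 and ℓ = j + 1, and write  window ℓ m  for the last ℓ
-- base-k digits of m (padded with leading zeros).  Both conditions of the
-- lemma are compared with a third one: a "window rule" h : Σ_k^ℓ → {±1} with
--     a(m) = a(⌊m/k⌋) · h(window ℓ m)      for all m.                     (R)
-- * (1) ⇒ (R): appending the last digit of m to the zero-padded expansion of
--   ⌊m/k⌋ creates exactly one new factor of length ℓ, namely window ℓ m; so
--   a_A obeys (R) with h(w) = (-1)^[w ∈ A]   (aA-rule).
-- * (R) ⇒ (2): by induction on α, a(k^α n + r)/a(n) is the quotient for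
--   (α-1, ⌊r/k⌋) times h(window ℓ (k^α n + r)), and that window is
--   k^(ℓ-1)-periodic in n   (rule⇒kernel-periodic).
-- * (2) ⇒ (R): the case α = 1 says a(kq + r)/a(q) only depends on q mod
--   k^(ℓ-1), i.e. on window ℓ (kq + r)   (kernel-periodic⇒rule).
-- * (R) ⇒ (1): take A = {w : h(w) = -}.  The zero word is not in A, since
--   (R) at m = 0 forces h(0^ℓ) = +; a_A obeys the same rule as a, and a
--   sequence obeying (R) is determined by its value at 0   (rule⇒aA).

open import Defs
open import Data.Nat using (ℕ; zero; suc; _∸_; _^_; _≤_; _<_)
open import Data.Fin using (Fin; toℕ)
open import Data.List using (List)
open import Data.List.Relation.Unary.All using (All)
open import Data.List.Relation.Unary.Unique.Propositional using (Unique)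
open import Data.Vec using (Vec)
import Data.Vec.Relation.Unary.All as VAll
open import Data.Sign using (Sign)
open import Data.Product using (Σ; _×_)
open import Function.Bundles using (_⇔_)
open import Relation.Nullary using (¬_)
open import Relation.Binary.PropositionalEquality using (_≡_)

open import Data.Nat using (_+_; _*_; NonZero; s≤s)
open import Data.Nat.Properties
open import Data.Nat.DivMod
  using (_/_; _%_; _mod_; m≡m%n+[m/n]*n; [m+kn]%n≡m%n; m*n/n≡m; +-distrib-/-∣ʳ; m/n<m; 0/n≡0; m%n<n; m%n≤m; m<n*o⇒m/o<n; /-congˡ)
open import Data.Nat.Divisibility using (divides-refl)
open import Data.Nat.Induction using (<-rec)
open import Data.Nat.Tactic.RingSolver using (solve-∀)
import Data.Fin as F
import Data.Fin.Properties as FP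
open import Data.List using ([]; _∷_; _++_; [_]; length; take; replicate; map; foldl; filter; allFin; cartesianProductWith)
open import Data.Nat.ListAction using (sum)
import Data.List.Properties as LP
open import Data.List.Properties using (≡-dec)
import Data.List.Relation.Unary.All as LAll
import Data.List.Relation.Unary.AllPairs as AllPairs
open import Data.List.Relation.Unary.Any using (here; there)
open import Data.List.Membership.Propositional using (_∈_; _∉_)
open import Data.List.Membership.Propositional.Properties using (∈-filter⁺; ∈-filter⁻; ∈-cartesianProductWith⁺; ∈-allFin)
import Data.List.Relation.Unary.Unique.Propositional.Properties as Unique
import Data.Vec as V
import Data.Vec.Properties as VP
open import Data.Vec using (toList; _∷ʳ_)
import Data.Sign.Properties as SP
open import Data.Sign using (opposite) renaming (_*_ to _*ˢ_)
open import Algebra.Properties.CommutativeSemigroup SP.*-commutativeSemigroup using (xy∙z≈xz∙y; x∙yz≈y∙xz)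
open import Data.Product using (_,_; proj₂)
open import Relation.Nullary using (Dec; yes; no; contradiction)
open import Relation.Binary.Definitions using (DecidableEquality)
open import Relation.Binary.PropositionalEquality using (_≗_; _≢_; refl; sym; trans; cong; cong₂; subst; module ≡-Reasoning)
open import Function.Bundles using (mk⇔)

open ≡-Reasoning

signPow-+ : ∀ m n → signPow (m + n) ≡ signPow m *ˢ signPow n
signPow-+ zero n = refl
signPow-+ (suc m) n with signPow m | signPow-+ m n
... | Sign.+ | eq = cong opposite eq
... | Sign.- | eq = trans (cong opposite eq) (SP.opposite-involutive _)

sign-recover : ∀ s t → s ≡ t *ˢ (s *ˢ t)
sign-recover s t = begin
  s                ≡⟨ sym (SP.*-identityʳ s) ⟩
  s *ˢ Sign.+      ≡⟨ cong (s *ˢ_) (sym (SP.s*s≡+ t)) ⟩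
  s *ˢ (t *ˢ t)    ≡⟨ x∙yz≈y∙xz s t t ⟩
  t *ˢ (s *ˢ t)    ∎

≢-⇒+ : ∀ s → s ≢ Sign.- → s ≡ Sign.+
≢-⇒+ Sign.+ _ = refl
≢-⇒+ Sign.- s≢- = contradiction refl s≢-

indicator : ∀ {p} {P : Set p} → Dec P → ℕ
indicator (yes _) = 1
indicator (no _) = 0

indicator-yes : ∀ {p} {P : Set p} → P → (d : Dec P) → indicator d ≡ 1
indicator-yes _ (yes _) = refl
indicator-yes p (no ¬p) = contradiction p ¬p

indicator-no : ∀ {p} {P : Set p} → ¬ P → (d : Dec P) → indicator d ≡ 0
indicator-no ¬p (yes p) = contradiction p ¬p
indicator-no _ (no _) = refl

indicator-⇔ : ∀ {p q} {P : Set p} {Q : Set q} → (P → Q) → (Q → P) →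
  (d : Dec P) (e : Dec Q) → indicator d ≡ indicator e
indicator-⇔ to from (yes p) e = sym (indicator-yes (to p) e)
indicator-⇔ to from (no ¬p) e = sym (indicator-no (λ q → ¬p (from q)) e)

module _ {X : Set} (_≟_ : DecidableEquality X) where

  multiplicity : X → List X → ℕ
  multiplicity x xs = sum (map (λ y → indicator (x ≟ y)) xs)

  multiplicity-∉ : ∀ {x} xs → x ∉ xs → multiplicity x xs ≡ 0
  multiplicity-∉ [] _ = refl
  multiplicity-∉ (y ∷ ys) x∉ =
    cong₂ _+_ (indicator-no (λ x≡y → x∉ (here x≡y)) _) (multiplicity-∉ ys (λ x∈ → x∉ (there x∈)))

  multiplicity-∈ : ∀ {x} xs → Unique xs → x ∈ xs → multiplicity x xs ≡ 1
  multiplicity-∈ (y ∷ ys) (y∉ys AllPairs.∷ _) (here x≡y) =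
    cong₂ _+_ (indicator-yes x≡y _) (multiplicity-∉ ys (λ x∈ → LAll.lookup y∉ys x∈ (sym x≡y)))
  multiplicity-∈ (y ∷ ys) (y∉ys AllPairs.∷ u) (there x∈) =
    cong₂ _+_ (indicator-no (λ x≡y → LAll.lookup y∉ys x∈ (sym x≡y)) _) (multiplicity-∈ ys u x∈)

HasPeriod-multiple : ∀ {p f} → HasPeriod p f → ∀ x c → f (x + c * p) ≡ f x
HasPeriod-multiple {p} {f} per x zero = cong f (+-identityʳ x)
HasPeriod-multiple {p} {f} per x (suc c) = begin
  f (x + (p + c * p))  ≡⟨ cong (λ t → f (x + t)) (+-comm p (c * p)) ⟩
  f (x + (c * p + p))  ≡⟨ cong f (sym (+-assoc x (c * p) p)) ⟩
  f ((x + c * p) + p)  ≡⟨ per (x + c * p) ⟩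
  f (x + c * p)        ≡⟨ HasPeriod-multiple per x c ⟩
  f x                  ∎

HasPeriod-* : ∀ {p f g} → HasPeriod p f → HasPeriod p g → HasPeriod p (λ n → f n *ˢ g n)
HasPeriod-* perf perg n = cong₂ _*ˢ_ (perf n) (perg n)

module _ {k : ℕ} where

  match : List (Fin k) → List (Fin k) → ℕ
  match u v = indicator (≡-dec F._≟_ u v)

  occ-∷ : ∀ v d w → occ v (d ∷ w) ≡ match (take (length v) (d ∷ w)) v + occ v w
  occ-∷ v d w with ≡-dec F._≟_ (take (length v) (d ∷ w)) v
  ... | yes _ = refl
  ... | no _ = refl

  occ-[] : ∀ v → occ v [] ≡ match v []
  occ-[] v with ≡-dec F._≟_ v []
  ... | yes _ = refl
  ... | no _ = refl

  occ-short : ∀ v w → length w < length v → occ v w ≡ 0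
  occ-short v [] lt = trans (occ-[] v) (indicator-no (λ { refl → <-irrefl refl lt }) _)
  occ-short v (d ∷ w) lt = begin
    occ v (d ∷ w)                                  ≡⟨ occ-∷ v d w ⟩
    match (take (length v) (d ∷ w)) v + occ v w    ≡⟨ cong (λ t → match t v + occ v w) (LP.take-all (length v) (d ∷ w) (<⇒≤ lt)) ⟩
    match (d ∷ w) v + occ v w                      ≡⟨ cong₂ _+_ (indicator-no (λ e → <-irrefl (cong length e) lt) _)
                                                                (occ-short v w (≤-trans (n≤1+n _) lt)) ⟩
    0                                              ∎

  occ-same-length : ∀ v t → length t ≡ length v → occ v t ≡ match t v
  occ-same-length v [] _ = trans (occ-[] v) (indicator-⇔ sym sym _ _)
  occ-same-length v (d ∷ t) eq = begin
    occ v (d ∷ t)                                  ≡⟨ occ-∷ v d t ⟩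
    match (take (length v) (d ∷ t)) v + occ v t    ≡⟨ cong₂ _+_ (cong (λ u → match u v) (LP.take-all (length v) (d ∷ t) (≤-reflexive eq)))
                                                                (occ-short v t (≤-reflexive eq)) ⟩
    match (d ∷ t) v + 0                            ≡⟨ +-identityʳ _ ⟩
    match (d ∷ t) v                                ∎

  take-++ : ∀ n (xs ys : List (Fin k)) → n ≤ length xs → take n (xs ++ ys) ≡ take n xs
  take-++ zero xs ys _ = refl
  take-++ (suc n) (x ∷ xs) ys (s≤s n≤) = cong (x ∷_) (take-++ n xs ys n≤)

  -- Appending a letter x to a word ending in s, with |v| = |s| + 1, creates
  -- exactly one new candidate factor of length |v|: the suffix s ++ [x].
  occ-snoc : ∀ v x (p s : List (Fin k)) → length v ≡ suc (length s) →
    occ v ((p ++ s) ++ [ x ]) ≡ occ v (p ++ s) + match (s ++ [ x ]) v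
  occ-snoc v x [] s hv = begin
    occ v (s ++ [ x ])              ≡⟨ occ-same-length v (s ++ [ x ]) (trans (LP.length-++ s) (trans (+-comm (length s) 1) (sym hv))) ⟩
    match (s ++ [ x ]) v            ≡⟨ cong (_+ match (s ++ [ x ]) v) (sym (occ-short v s (≤-reflexive (sym hv)))) ⟩
    occ v s + match (s ++ [ x ]) v  ∎
  occ-snoc v x (y ∷ p) s hv = begin
    occ v (y ∷ ((p ++ s) ++ [ x ]))
      ≡⟨ occ-∷ v y _ ⟩
    match (take (length v) (y ∷ ((p ++ s) ++ [ x ]))) v + occ v ((p ++ s) ++ [ x ])
      ≡⟨ cong₂ _+_ (cong (λ t → match t v) (take-++ (length v) (y ∷ (p ++ s)) [ x ] long)) (occ-snoc v x p s hv) ⟩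
    match (take (length v) (y ∷ (p ++ s))) v + (occ v (p ++ s) + match (s ++ [ x ]) v)
      ≡⟨ sym (+-assoc (match (take (length v) (y ∷ (p ++ s))) v) _ _) ⟩
    match (take (length v) (y ∷ (p ++ s))) v + occ v (p ++ s) + match (s ++ [ x ]) v
      ≡⟨ cong (_+ match (s ++ [ x ]) v) (sym (occ-∷ v y (p ++ s))) ⟩
    occ v (y ∷ (p ++ s)) + match (s ++ [ x ]) v ∎
    where
    long : length v ≤ length (y ∷ (p ++ s))
    long = subst (_≤ suc (length (p ++ s))) (sym hv)
             (s≤s (subst (length s ≤_) (sym (LP.length-++ p)) (m≤n+m (length s) (length p))))

toList-injective : ∀ {X : Set} {n} (u v : Vec X n) → toList u ≡ toList v → u ≡ v
toList-injective u v eq = trans (sym (VP.cast-is-id refl u)) (VP.toList-injective refl u v eq)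

allWords : (k j : ℕ) → List (Vec (Fin k) j)
allWords k zero = V.[] ∷ []
allWords k (suc j) = cartesianProductWith V._∷_ (allFin k) (allWords k j)

allWords-unique : ∀ k j → Unique (allWords k j)
allWords-unique k zero = LAll.[] AllPairs.∷ AllPairs.[]
allWords-unique k (suc j) = Unique.cartesianProductWith⁺ V._∷_ VP.∷-injective (Unique.allFin⁺ k) (allWords-unique k j)

allWords-complete : ∀ k j (v : Vec (Fin k) j) → v ∈ allWords k j
allWords-complete k zero V.[] = here refl
allWords-complete k (suc j) (x V.∷ v) = ∈-cartesianProductWith⁺ V._∷_ (∈-allFin x) (allWords-complete k j v)

module _ (k : ℕ) (hk : 2 ≤ k) where
  instance
    k≢0 : NonZero k
    k≢0 = nz hk

  private
    Digit : Set
    Digit = Fin k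

    𝟎 : Digit
    𝟎 = zeroDigit k hk

  toℕ-𝟎 : toℕ 𝟎 ≡ 0
  toℕ-𝟎 = n≤0⇒n≡0 (subst (_≤ 0) (sym (FP.toℕ-fromℕ< (m%n<n 0 k))) (m%n≤m 0 k))

  /-shift : ∀ x c → (x + c * k) / k ≡ x / k + c
  /-shift x c = trans (+-distrib-/-∣ʳ x (divides-refl c)) (cong (x / k +_) (m*n/n≡m c k))

  mod-shift : ∀ x c → (x + c * k) mod k ≡ x mod k
  mod-shift x c = FP.fromℕ<-cong _ _ ([m+kn]%n≡m%n x c k) _ _

  /-decreasing : ∀ n → suc n / k < suc n
  /-decreasing n = m/n<m (suc n) k hk

  digitsAux-fuel : ∀ f g n → n ≤ f → n ≤ g → digitsAux k f n ≡ digitsAux k g n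
  digitsAux-fuel zero zero zero _ _ = refl
  digitsAux-fuel zero (suc g) zero _ _ = refl
  digitsAux-fuel (suc f) zero zero _ _ = refl
  digitsAux-fuel (suc f) (suc g) zero _ _ = refl
  digitsAux-fuel (suc f) (suc g) (suc n) (s≤s n≤f) (s≤s n≤g) =
    cong (_++ [ suc n mod k ]) (digitsAux-fuel f g (suc n / k) (≤-trans (≤-pred (/-decreasing n)) n≤f) (≤-trans (≤-pred (/-decreasing n)) n≤g))

  digits-suc : ∀ n → digits k hk (suc n) ≡ digits k hk (suc n / k) ++ [ suc n mod k ]
  digits-suc n = cong (_++ [ suc n mod k ]) (digitsAux-fuel n (suc n / k) (suc n / k) (≤-pred (/-decreasing n)) ≤-refl)

  window : (j : ℕ) → ℕ → Vec Digit j
  window zero m = V.[]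
  window (suc j) m = window j (m / k) ∷ʳ (m mod k)

  toList-window-suc : ∀ j m → toList (window (suc j) m) ≡ toList (window j (m / k)) ++ [ m mod k ]
  toList-window-suc j m = VP.toList-∷ʳ (m mod k) (window j (m / k))

  window-zero : ∀ j → window j 0 ≡ V.replicate j 𝟎
  window-zero zero = refl
  window-zero (suc j) = begin
    window j (0 / k) ∷ʳ 𝟎      ≡⟨ cong (λ t → window j t ∷ʳ 𝟎) (0/n≡0 k) ⟩
    window j 0 ∷ʳ 𝟎            ≡⟨ cong (_∷ʳ 𝟎) (window-zero j) ⟩
    V.replicate j 𝟎 ∷ʳ 𝟎       ≡⟨ replicate-∷ʳ j ⟩
    V.replicate (suc j) 𝟎      ∎
    where
    replicate-∷ʳ : ∀ j → V.replicate j 𝟎 ∷ʳ 𝟎 ≡ V.replicate (suc j) 𝟎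
    replicate-∷ʳ zero = refl
    replicate-∷ʳ (suc j) = cong (𝟎 V.∷_) (replicate-∷ʳ j)

  window-periodic : ∀ j x c → window j (x + c * k ^ j) ≡ window j x
  window-periodic zero x c = refl
  window-periodic (suc j) x c = cong₂ _∷ʳ_
    (begin
      window j ((x + c * (k * k ^ j)) / k)  ≡⟨ cong (λ t → window j (t / k)) regroup ⟩
      window j ((x + c * k ^ j * k) / k)    ≡⟨ cong (window j) (/-shift x (c * k ^ j)) ⟩
      window j (x / k + c * k ^ j)          ≡⟨ window-periodic j (x / k) c ⟩
      window j (x / k)                      ∎)
    (trans (cong (_mod k) regroup) (mod-shift x (c * k ^ j)))
    where
    regroup : x + c * (k * k ^ j) ≡ x + c * k ^ j * k
    regroup = cong (x +_) (trans (cong (c *_) (*-comm k (k ^ j))) (sym (*-assoc c (k ^ j) k)))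

  value : ∀ {j} → Vec Digit j → ℕ
  value w = foldl (λ acc d → acc * k + toℕ d) 0 (toList w)

  value-∷ʳ : ∀ {j} (w : Vec Digit j) d → value (w ∷ʳ d) ≡ value w * k + toℕ d
  value-∷ʳ w d = trans (cong (foldl (λ acc d → acc * k + toℕ d) 0) (VP.toList-∷ʳ d w))
                       (LP.foldl-++ (λ acc d → acc * k + toℕ d) 0 (toList w) [ d ])

  window-value : ∀ j m → Σ ℕ λ c → m ≡ value (window j m) + c * k ^ j
  window-value zero m = m , sym (*-identityʳ m)
  window-value (suc j) m with window-value j (m / k)
  ... | c , eq = c , (begin
      m                                         ≡⟨ m≡m%n+[m/n]*n m k ⟩
      m % k + m / k * k                         ≡⟨ cong (λ t → m % k + t * k) eq ⟩
      m % k + (v + c * k ^ j) * k               ≡⟨ regroup (m % k) v c k (k ^ j) ⟩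
      (v * k + m % k) + c * (k * k ^ j)         ≡⟨ cong (_+ c * k ^ suc j) (sym last) ⟩
      value (window (suc j) m) + c * k ^ suc j  ∎)
    where
    v : ℕ
    v = value (window j (m / k))
    regroup : ∀ r v c k K → r + (v + c * K) * k ≡ (v * k + r) + c * (k * K)
    regroup = solve-∀
    last : value (window (suc j) m) ≡ v * k + m % k
    last = trans (value-∷ʳ (window j (m / k)) (m mod k)) (cong (v * k +_) (FP.toℕ-fromℕ< (m%n<n m k)))

  ends-with-window : ∀ j m L → j ≤ L → Σ (List Digit) λ p → replicate L 𝟎 ++ digits k hk m ≡ p ++ toList (window j m)
  ends-with-window j zero L j≤L = replicate (L ∸ j) 𝟎 , (begin
    replicate L 𝟎 ++ []                        ≡⟨ LP.++-identityʳ _ ⟩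
    replicate L 𝟎                              ≡⟨ cong (λ t → replicate t 𝟎) (sym (m∸n+n≡m j≤L)) ⟩
    replicate ((L ∸ j) + j) 𝟎                  ≡⟨ replicate-+ (L ∸ j) j ⟩
    replicate (L ∸ j) 𝟎 ++ replicate j 𝟎       ≡⟨ cong (replicate (L ∸ j) 𝟎 ++_) (sym zeros) ⟩
    replicate (L ∸ j) 𝟎 ++ toList (window j 0) ∎)
    where
    replicate-+ : ∀ a b → replicate (a + b) 𝟎 ≡ replicate a 𝟎 ++ replicate b 𝟎
    replicate-+ zero b = refl
    replicate-+ (suc a) b = cong (𝟎 ∷_) (replicate-+ a b)
    zeros : toList (window j 0) ≡ replicate j 𝟎
    zeros = trans (cong toList (window-zero j)) (VP.toList-replicate j 𝟎)
  ends-with-window zero (suc m) L _ = replicate L 𝟎 ++ digits k hk (suc m) , sym (LP.++-identityʳ _)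
  ends-with-window (suc j) (suc m) L j<L with ends-with-window j (suc m / k) L (≤-trans (n≤1+n j) j<L)
  ... | p , eq = p , (begin
    R ++ digits k hk (suc m)                             ≡⟨ cong (R ++_) (digits-suc m) ⟩
    R ++ (digits k hk (suc m / k) ++ [ d ])              ≡⟨ sym (LP.++-assoc R _ _) ⟩
    (R ++ digits k hk (suc m / k)) ++ [ d ]              ≡⟨ cong (_++ [ d ]) eq ⟩
    (p ++ toList (window j (suc m / k))) ++ [ d ]        ≡⟨ LP.++-assoc p _ _ ⟩
    p ++ (toList (window j (suc m / k)) ++ [ d ])        ≡⟨ cong (p ++_) (sym (toList-window-suc j (suc m))) ⟩
    p ++ toList (window (suc j) (suc m))                 ∎)
    where
    R : List Digit
    R = replicate L 𝟎
    d : Digit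
    d = suc m mod k

  _≟ʷ_ : ∀ {j} → DecidableEquality (Vec Digit j)
  _≟ʷ_ = VP.≡-dec F._≟_

  IsZeroWord : ∀ {j} → Vec Digit j → Set
  IsZeroWord = VAll.All (λ d → toℕ d ≡ 0)

  window-zero-isZero : ∀ j → IsZeroWord (window j 0)
  window-zero-isZero j = subst IsZeroWord (sym (window-zero j)) (replicate-isZero j)
    where
    replicate-isZero : ∀ j → IsZeroWord (V.replicate j 𝟎)
    replicate-isZero zero = VAll.[]
    replicate-isZero (suc j) = toℕ-𝟎 VAll.∷ replicate-isZero j

  isZero⇒window-zero : ∀ {j} (v : Vec Digit j) → IsZeroWord v → v ≡ window j 0
  isZero⇒window-zero v zv = trans (isZero⇒replicate v zv) (sym (window-zero _))
    where
    isZero⇒replicate : ∀ {j} (v : Vec Digit j) → IsZeroWord v → v ≡ V.replicate j 𝟎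
    isZero⇒replicate V.[] VAll.[] = refl
    isZero⇒replicate (d V.∷ v) (d≡0 VAll.∷ zv) =
      cong₂ V._∷_ (FP.toℕ-injective (trans d≡0 (sym toℕ-𝟎))) (isZero⇒replicate v zv)

  #occ-unfold : ∀ j v m → length v ≡ suc j → #occ k hk v m ≡ occ v (replicate j 𝟎 ++ digits k hk m)
  #occ-unfold j v m hv = cong (λ n → occ v (replicate (n ∸ 1) 𝟎 ++ digits k hk m)) hv

  -- 0^j (0)_k = 0^j is too short to contain a word of length j + 1
  #occ-0 : ∀ j v → length v ≡ suc j → #occ k hk v 0 ≡ 0
  #occ-0 j v hv = trans (#occ-unfold j v 0 hv) (occ-short v (replicate j 𝟎 ++ []) short)
    where
    short : length (replicate j 𝟎 ++ []) < length v
    short = subst (_< length v) (sym (trans (cong length (LP.++-identityʳ (replicate j 𝟎))) (LP.length-replicate j {𝟎}))) (≤-reflexive (sym hv))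

  #occ-suc : ∀ j v m → length v ≡ suc j →
    #occ k hk v (suc m) ≡ #occ k hk v (suc m / k) + match (toList (window (suc j) (suc m))) v
  #occ-suc j v m hv with ends-with-window j (suc m / k) j ≤-refl
  ... | p , eq = begin
    #occ k hk v (suc m)                                  ≡⟨ #occ-unfold j v (suc m) hv ⟩
    occ v (R ++ digits k hk (suc m))                     ≡⟨ cong (λ t → occ v (R ++ t)) (digits-suc m) ⟩
    occ v (R ++ (digits k hk q ++ [ d ]))                ≡⟨ cong (occ v) (sym (LP.++-assoc R _ _)) ⟩
    occ v ((R ++ digits k hk q) ++ [ d ])                ≡⟨ cong (λ t → occ v (t ++ [ d ])) eq ⟩
    occ v ((p ++ W) ++ [ d ])                            ≡⟨ occ-snoc v d p W (trans hv (cong suc (sym (VP.length-toList (window j q))))) ⟩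
    occ v (p ++ W) + match (W ++ [ d ]) v                ≡⟨ cong₂ _+_ (cong (occ v) (sym eq)) (cong (λ t → match t v) (sym (toList-window-suc j (suc m)))) ⟩
    occ v (R ++ digits k hk q) + match (toList (window (suc j) (suc m))) v
                                                         ≡⟨ cong (_+ match (toList (window (suc j) (suc m))) v) (sym (#occ-unfold j v q hv)) ⟩
    #occ k hk v q + match (toList (window (suc j) (suc m))) v ∎
    where
    q : ℕ
    q = suc m / k
    d : Digit
    d = suc m mod k
    R : List Digit
    R = replicate j 𝟎
    W : List Digit
    W = toList (window j q)

  #occ-step : ∀ j (v : Vec Digit (suc j)) → ¬ IsZeroWord v → ∀ m →
    #occ k hk (toList v) m ≡ #occ k hk (toList v) (m / k) + indicator (window (suc j) m ≟ʷ v)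
  #occ-step j v v≢0 zero = begin
    #occ k hk (toList v) 0                                       ≡⟨ #occ-0 j (toList v) (VP.length-toList v) ⟩
    0                                                            ≡⟨ sym (cong₂ _+_ at-0/k (indicator-no window≢v _)) ⟩
    #occ k hk (toList v) (0 / k) + indicator (window (suc j) 0 ≟ʷ v) ∎
    where
    at-0/k : #occ k hk (toList v) (0 / k) ≡ 0
    at-0/k = trans (cong (#occ k hk (toList v)) (0/n≡0 k)) (#occ-0 j (toList v) (VP.length-toList v))
    window≢v : ¬ (window (suc j) 0 ≡ v)
    window≢v eq = v≢0 (subst IsZeroWord eq (window-zero-isZero (suc j)))
  #occ-step j v v≢0 (suc m) = trans (#occ-suc j (toList v) m (VP.length-toList v))
    (cong (#occ k hk (toList v) (suc m / k) +_)
          (indicator-⇔ (toList-injective (window (suc j) (suc m)) v) (cong toList)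
                       (≡-dec F._≟_ (toList (window (suc j) (suc m))) (toList v)) (window (suc j) (suc m) ≟ʷ v)))

  factorCount : ∀ {ℓ} → List (Vec Digit ℓ) → ℕ → ℕ
  factorCount A m = sum (map (λ v → #occ k hk (toList v) m) A)

  factorCount-0 : ∀ j (A : List (Vec Digit (suc j))) → factorCount A 0 ≡ 0
  factorCount-0 j [] = refl
  factorCount-0 j (v ∷ A) = cong₂ _+_ (#occ-0 j (toList v) (VP.length-toList v)) (factorCount-0 j A)

  factorCount-step : ∀ j (A : List (Vec Digit (suc j))) → All (λ v → ¬ IsZeroWord v) A → ∀ m →
    factorCount A m ≡ factorCount A (m / k) + multiplicity _≟ʷ_ (window (suc j) m) A
  factorCount-step j [] _ m = refl
  factorCount-step j (v ∷ A) (v≢0 LAll.∷ A≢0) m = begin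
    #occ k hk (toList v) m + factorCount A m
      ≡⟨ cong₂ _+_ (#occ-step j v v≢0 m) (factorCount-step j A A≢0 m) ⟩
    (#occ k hk (toList v) (m / k) + indicator (w ≟ʷ v)) + (factorCount A (m / k) + multiplicity _≟ʷ_ w A)
      ≡⟨ +-interchange (#occ k hk (toList v) (m / k)) _ _ _ ⟩
    (#occ k hk (toList v) (m / k) + factorCount A (m / k)) + (indicator (w ≟ʷ v) + multiplicity _≟ʷ_ w A) ∎
    where
    w : Vec Digit (suc j)
    w = window (suc j) m
    +-interchange : ∀ a b c d → (a + b) + (c + d) ≡ (a + c) + (b + d)
    +-interchange = solve-∀

  WindowRule : (ℓ : ℕ) → (ℕ → Sign) → (Vec Digit ℓ → Sign) → Set
  WindowRule ℓ a h = ∀ m → a m ≡ a (m / k) *ˢ h (window ℓ m)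

  rule-cong : ∀ {ℓ a b h h′} → a ≗ b → h ≗ h′ → WindowRule ℓ a h → WindowRule ℓ b h′
  rule-cong {ℓ} {a} {b} {h} {h′} a≗b h≗h′ rule m = begin
    b m                              ≡⟨ sym (a≗b m) ⟩
    a m                              ≡⟨ rule m ⟩
    a (m / k) *ˢ h (window ℓ m)      ≡⟨ cong₂ _*ˢ_ (a≗b (m / k)) (h≗h′ (window ℓ m)) ⟩
    b (m / k) *ˢ h′ (window ℓ m)     ∎

  -- at m = 0 the rule reads a(0) = a(0) · h(0^ℓ), so h(0^ℓ) = +
  rule-at-zero : ∀ {ℓ a h} → WindowRule ℓ a h → h (window ℓ 0) ≡ Sign.+
  rule-at-zero {ℓ} {a} {h} rule = sym (SP.*-cancelˡ-≡ (a 0) Sign.+ (h (window ℓ 0)) (begin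
    a 0 *ˢ Sign.+              ≡⟨ SP.*-identityʳ (a 0) ⟩
    a 0                        ≡⟨ rule 0 ⟩
    a (0 / k) *ˢ h (window ℓ 0) ≡⟨ cong (λ t → a t *ˢ h (window ℓ 0)) (0/n≡0 k) ⟩
    a 0 *ˢ h (window ℓ 0)      ∎))

  rule-unique : ∀ {ℓ a b h} → WindowRule ℓ a h → WindowRule ℓ b h → a 0 ≡ b 0 → a ≗ b
  rule-unique {ℓ} {a} {b} {h} rule-a rule-b a0≡b0 = <-rec (λ m → a m ≡ b m) step
    where
    step : ∀ m → (∀ {n} → n < m → a n ≡ b n) → a m ≡ b m
    step zero _ = a0≡b0
    step (suc m) IH = begin
      a (suc m)                                   ≡⟨ rule-a (suc m) ⟩
      a (suc m / k) *ˢ h (window ℓ (suc m))       ≡⟨ cong (_*ˢ h (window ℓ (suc m))) (IH (/-decreasing m)) ⟩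
      b (suc m / k) *ˢ h (window ℓ (suc m))       ≡⟨ sym (rule-b (suc m)) ⟩
      b (suc m)                                   ∎

  membershipSign : ∀ {ℓ} → List (Vec Digit ℓ) → Vec Digit ℓ → Sign
  membershipSign A w = signPow (multiplicity _≟ʷ_ w A)

  aA-rule : ∀ j (A : List (Vec Digit (suc j))) → All (λ v → ¬ IsZeroWord v) A →
    WindowRule (suc j) (aA k hk (suc j) A) (membershipSign A)
  aA-rule j A A≢0 m = trans (cong signPow (factorCount-step j A A≢0 m))
                            (signPow-+ (factorCount A (m / k)) (multiplicity _≟ʷ_ (window (suc j) m) A))

  -- (R) ⇒ (2): the quotient for (α+1, r) is the quotient for (α, ⌊r/k⌋) times
  -- h (window (j+1) (k^(α+1) n + r)), and that window is k^j-periodic in n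
  rule⇒kernel-periodic : ∀ j a h → WindowRule (suc j) a h →
    ∀ α r → r < k ^ α → HasPeriod (k ^ j) (λ n → kernelElt k a α r n ÷ a n)
  rule⇒kernel-periodic j a h rule zero zero _ n = trans (trivial (n + k ^ j)) (sym (trivial n))
    where
    trivial : ∀ n → a (1 * n + 0) *ˢ a n ≡ Sign.+
    trivial n = trans (cong (λ t → a t *ˢ a n) (trans (+-identityʳ (1 * n)) (*-identityˡ n))) (SP.s*s≡+ (a n))
  rule⇒kernel-periodic j a h rule zero (suc r) (s≤s ())
  rule⇒kernel-periodic j a h rule (suc α) r r<k^[1+α] n =
    trans (factor (n + K)) (trans (HasPeriod-* previous window-periodic-in-n n) (sym (factor n)))
    where
    K A : ℕ
    K = k ^ j
    A = k ^ α
    previous : HasPeriod K (λ n → a (A * n + r / k) *ˢ a n)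
    previous = rule⇒kernel-periodic j a h rule α (r / k) (m<n*o⇒m/o<n (subst (r <_) (*-comm k A) r<k^[1+α]))
    H : ℕ → Sign
    H n = h (window (suc j) (k * A * n + r))
    window-periodic-in-n : HasPeriod K H
    window-periodic-in-n n = cong h (trans (cong (window (suc j)) (regroup k A K n r)) (window-periodic (suc j) (k * A * n + r) A))
      where
      regroup : ∀ k A K n r → k * A * (n + K) + r ≡ (k * A * n + r) + A * (k * K)
      regroup = solve-∀
    quotient : ∀ n → (k * A * n + r) / k ≡ A * n + r / k
    quotient n = begin
      (k * A * n + r) / k    ≡⟨ /-congˡ (regroup k A n r) ⟩
      (r + A * n * k) / k    ≡⟨ /-shift r (A * n) ⟩
      r / k + A * n          ≡⟨ +-comm (r / k) (A * n) ⟩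
      A * n + r / k          ∎
      where
      regroup : ∀ k A n r → k * A * n + r ≡ r + A * n * k
      regroup = solve-∀
    factor : ∀ n → a (k * A * n + r) *ˢ a n ≡ (a (A * n + r / k) *ˢ a n) *ˢ H n
    factor n = begin
      a (k * A * n + r) *ˢ a n                      ≡⟨ cong (_*ˢ a n) (rule (k * A * n + r)) ⟩
      (a ((k * A * n + r) / k) *ˢ H n) *ˢ a n       ≡⟨ cong (λ t → (a t *ˢ H n) *ˢ a n) (quotient n) ⟩
      (a (A * n + r / k) *ˢ H n) *ˢ a n             ≡⟨ xy∙z≈xz∙y (a (A * n + r / k)) (H n) (a n) ⟩
      (a (A * n + r / k) *ˢ a n) *ˢ H n             ∎

  ruleOf : (ℕ → Sign) → ∀ {ℓ} → Vec Digit ℓ → Sign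
  ruleOf a w = a (value w) *ˢ a (value w / k)

  kernel-periodic⇒rule : ∀ j a → (∀ r → r < k → HasPeriod (k ^ j) (λ n → kernelElt k a 1 r n ÷ a n)) →
    WindowRule (suc j) a (ruleOf a)
  kernel-periodic⇒rule j a periodic m with window-value (suc j) m
  ... | c , m≡ = begin
      a m                                ≡⟨ sign-recover (a m) (a (m / k)) ⟩
      a (m / k) *ˢ (a m *ˢ a (m / k))    ≡⟨ cong (a (m / k) *ˢ_) quotient-is-rule ⟩
      a (m / k) *ˢ ruleOf a (window (suc j) m) ∎
    where
    v r : ℕ
    v = value (window (suc j) m)
    r = m % k
    f : ℕ → Sign
    f n = a (k * 1 * n + r) *ˢ a n
    euclid : ∀ x → x ≡ k * 1 * (x / k) + x % k
    euclid x = trans (m≡m%n+[m/n]*n x k) (trans (+-comm (x % k) (x / k * k))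
                 (cong (_+ x % k) (trans (*-comm (x / k) k) (cong (_* (x / k)) (sym (*-identityʳ k))))))
    m≡′ : m ≡ v + c * k ^ j * k
    m≡′ = trans m≡ (cong (v +_) (trans (cong (c *_) (*-comm k (k ^ j))) (sym (*-assoc c (k ^ j) k))))
    m/k≡ : m / k ≡ v / k + c * k ^ j
    m/k≡ = trans (/-congˡ m≡′) (/-shift v (c * k ^ j))
    m%k≡ : m % k ≡ v % k
    m%k≡ = trans (cong (_% k) m≡′) ([m+kn]%n≡m%n v (c * k ^ j) k)
    -- m and value (window m) share the last digit, and their quotients by k
    -- differ by a multiple of k^j
    quotient-is-rule : a m *ˢ a (m / k) ≡ a v *ˢ a (v / k)
    quotient-is-rule = begin
      a m *ˢ a (m / k)           ≡⟨ cong (λ t → a t *ˢ a (m / k)) (euclid m) ⟩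
      f (m / k)                  ≡⟨ cong f m/k≡ ⟩
      f (v / k + c * k ^ j)      ≡⟨ HasPeriod-multiple (periodic r (m%n<n m k)) (v / k) c ⟩
      f (v / k)                  ≡⟨ cong (λ t → a (k * 1 * (v / k) + t) *ˢ a (v / k)) m%k≡ ⟩
      a (k * 1 * (v / k) + v % k) *ˢ a (v / k)
                                 ≡⟨ cong (λ t → a t *ˢ a (v / k)) (sym (euclid v)) ⟩
      a v *ˢ a (v / k)           ∎

  -- (R) ⇒ (1): A = {w : h(w) = -} has no zero word (h(0^ℓ) = + by rule-at-zero),
  -- a_A obeys the same rule as a, and both take the value + at 0
  rule⇒aA : ∀ j a h → a 0 ≡ Sign.+ → WindowRule (suc j) a h →
    Σ (List (Vec Digit (suc j))) λ A →
      Unique A × All (λ v → ¬ IsZeroWord v) A × (∀ n → a n ≡ aA k hk (suc j) A n)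
  rule⇒aA j a h a0 rule = A , A-unique , A≢0 , rule-unique {h = h} rule aA-follows-h a0≡
    where
    negative? : ∀ v → Dec (h v ≡ Sign.-)
    negative? v = h v SP.≟ Sign.-
    A : List (Vec Digit (suc j))
    A = filter negative? (allWords k (suc j))
    A-unique : Unique A
    A-unique = Unique.filter⁺ negative? (allWords-unique k (suc j))
    A≢0 : All (λ v → ¬ IsZeroWord v) A
    A≢0 = LAll.tabulate λ {v} v∈A zv → zero-word-positive v zv (proj₂ (∈-filter⁻ negative? {xs = allWords k (suc j)} v∈A))
      where
      zero-word-positive : ∀ v → IsZeroWord v → h v ≢ Sign.-
      zero-word-positive v zv hv≡- =
        contradiction (trans (sym (rule-at-zero {a = a} {h = h} rule)) (trans (cong h (sym (isZero⇒window-zero v zv))) hv≡-)) (λ ())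
    h≗ : ∀ v → h v ≡ membershipSign A v
    h≗ v with negative? v
    ... | yes hv≡- = trans hv≡- (cong signPow (sym (multiplicity-∈ _≟ʷ_ A A-unique
                        (∈-filter⁺ negative? (allWords-complete k (suc j) v) hv≡-))))
    ... | no hv≢- = trans (≢-⇒+ (h v) hv≢-) (cong signPow (sym (multiplicity-∉ _≟ʷ_ A
                        (λ v∈A → hv≢- (proj₂ (∈-filter⁻ negative? {xs = allWords k (suc j)} v∈A))))))
    aA-follows-h : WindowRule (suc j) (aA k hk (suc j) A) h
    aA-follows-h = rule-cong {h = membershipSign A} {h′ = h} (λ _ → refl) (λ v → sym (h≗ v)) (aA-rule j A A≢0)
    a0≡ : a 0 ≡ aA k hk (suc j) A 0
    a0≡ = trans a0 (cong signPow (sym (factorCount-0 j A)))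

lemma2p6 : (k : ℕ) (hk : 2 ≤ k) (ℓ : ℕ) → 1 ≤ ℓ → (a : ℕ → Sign) → a 0 ≡ Sign.+ →
    (Σ (List (Vec (Fin k) ℓ)) (λ A →
        Unique A × All (λ v → ¬ VAll.All (λ d → toℕ d ≡ 0) v) A × (∀ n → a n ≡ aA k hk ℓ A n)))
    ⇔
    (∀ α r → r < k ^ α → HasPeriod (k ^ (ℓ ∸ 1)) (λ n → kernelElt k a α r n ÷ a n))
lemma2p6 k hk zero () a a0
lemma2p6 k hk (suc j) _ a a0 = mk⇔
  (λ (A , _ , A≢0 , a≗aA) → rule⇒kernel-periodic k hk j a (membershipSign k hk A)
      (rule-cong k hk {h = membershipSign k hk A} (λ n → sym (a≗aA n)) (λ _ → refl) (aA-rule k hk j A A≢0)))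
  (λ periodic → rule⇒aA k hk j a (ruleOf k hk a) a0
      (kernel-periodic⇒rule k hk j a (λ r r<k → periodic 1 r (subst (r <_) (sym (*-identityʳ k)) r<k))))
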